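{- For a bridge/path cubical set $\Gamma$, the following are equivalent: (1) $\Gamma$ is discrete; (2) $\Gamma\cong\vartriangle\Theta$ for some cubical set $\Theta$; (3) the map $\kappa:\flat\Gamma\to\Gamma$ is an isomorphism.
   Context: $\mathrm{Cube}$: finite sets of names with face maps $\varphi:V\to W$ assigning each $i\in W$ a value in $\{0,1\}\cup V$. $\mathrm{BPCube}$: pairs $W=(W_B,W_P)$ of disjoint finite sets of names; face maps assign to bridge variables values in $\{0,1\}\cup V_B$ and to path variables values in $\{0,1\}\cup V_B\cup V_P$; composition by substitution. Cubical sets are presheaves on $\mathrm{Cube}$, bridge/path cubical sets presheaves on $\mathrm{BPCube}$. $\vartriangle\Theta := \Theta\circ\sqcap$ where $\sqcap:\mathrm{BPCube}\to\mathrm{Cube}$, $W\mapsto W_B$, $i\langle\sqcap\varphi\rangle=i\langle\varphi\rangle$. Let $\natural W:=(W_B,\emptyset)$ with $i\langle\natural\varphi\rangle = i\langle\varphi\rangle$ for bridge variables, and $\varsigma_W:W\to\natural W$ the face map sending each bridge variable to itself. Then $\flat\Gamma := \Gamma\circ\natural$ and $\kappa:\flat\Gamma\to\Gamma$ has components $\Gamma(\varsigma_W):\Gamma(\natural W)\to\Gamma(W)$. With $(W,i{:}\mathbb P)$ the extension by a fresh path variable and $(\setminus i):(W,i{:}\mathbb P)\to W$ the weakening, $\Gamma$ is discrete if every $\gamma\in\Gamma(W,i{:}\mathbb P)$ equals $\gamma'(\setminus i)$ for some $\gamma'\in\Gamma(W)$. -}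

module Defs where

open import Data.Nat using (ℕ; zero; suc)
open import Data.Fin using (Fin; zero; suc)
open import Data.Vec using (Vec; []; _∷_; lookup; tabulate; map)
open import Data.Product using (Σ; _×_; _,_)
open import Relation.Binary.PropositionalEquality using (_≡_; refl; cong; cong₂; sym; trans)
open import Data.Vec.Properties using (lookup∘tabulate; tabulate∘lookup; tabulate-∘)

-- Names: a finite set of n names is represented by Fin n (skeleton of the
-- category of finite sets of names).

data Val (n : ℕ) : Set where
  𝟎 𝟏 : Val n
  var : Fin n → Val n

-- a face map φ : V → W assigns to each i ∈ W a value in {0,1} ∪ V
CubeHom : ℕ → ℕ → Set
CubeHom v w = Vec (Val v) w

_⟪_⟫ : ∀ {u v} → Val v → CubeHom u v → Val u
𝟎 ⟪ φ ⟫ = 𝟎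
𝟏 ⟪ φ ⟫ = 𝟏
var j ⟪ φ ⟫ = lookup φ j

idᶜ : ∀ {v} → CubeHom v v
idᶜ = tabulate var

_∘ᶜ_ : ∀ {u v w} → CubeHom v w → CubeHom u v → CubeHom u w
ψ ∘ᶜ φ = map (_⟪ φ ⟫) ψ

record CSet : Set₁ where
  field
    ob    : ℕ → Set
    act   : ∀ {v w} → CubeHom v w → ob w → ob v
    act-id : ∀ {v} (x : ob v) → act (idᶜ {v}) x ≡ x
    act-∘ : ∀ {u v w} (ψ : CubeHom v w) (φ : CubeHom u v) (x : ob w) →
            act (ψ ∘ᶜ φ) x ≡ act φ (act ψ x)

-- The bridge/path cube category BPCube
-- objects: pairs (b , p) = numbers of bridge and path variables

data PVal (b p : ℕ) : Set where
  𝟎 𝟏 : PVal b p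
  bv  : Fin b → PVal b p
  pv  : Fin p → PVal b p

embed : ∀ {b p} → Val b → PVal b p
embed 𝟎 = 𝟎
embed 𝟏 = 𝟏
embed (var j) = bv j

record BPHom (vb vp wb wp : ℕ) : Set where
  constructor bphom
  field
    bridge : Vec (Val vb) wb
    path   : Vec (PVal vb vp) wp
open BPHom public

_⟪_⟫ᵖ : ∀ {ub up vb vp} → PVal vb vp → BPHom ub up vb vp → PVal ub up
𝟎 ⟪ φ ⟫ᵖ = 𝟎
𝟏 ⟪ φ ⟫ᵖ = 𝟏
bv j ⟪ φ ⟫ᵖ = embed (lookup (bridge φ) j)
pv j ⟪ φ ⟫ᵖ = lookup (path φ) j

idᵇᵖ : ∀ {b p} → BPHom b p b p
idᵇᵖ = bphom idᶜ (tabulate pv)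

_∘ᵇᵖ_ : ∀ {ub up vb vp wb wp} → BPHom vb vp wb wp → BPHom ub up vb vp →
        BPHom ub up wb wp
ψ ∘ᵇᵖ φ = bphom (bridge ψ ∘ᶜ bridge φ) (map (_⟪ φ ⟫ᵖ) (path ψ))

record BPSet : Set₁ where
  field
    ob    : ℕ → ℕ → Set
    act   : ∀ {vb vp wb wp} → BPHom vb vp wb wp → ob wb wp → ob vb vp
    act-id : ∀ {b p} (x : ob b p) → act (idᵇᵖ {b} {p}) x ≡ x
    act-∘ : ∀ {ub up vb vp wb wp}
            (ψ : BPHom vb vp wb wp) (φ : BPHom ub up vb vp) (x : ob wb wp) →
            act (ψ ∘ᵇᵖ φ) x ≡ act φ (act ψ x)
open BPSet public

record BPHomSet (F G : BPSet) : Set where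
  field
    at  : ∀ {b p} → ob F b p → ob G b p
    nat : ∀ {vb vp wb wp} (φ : BPHom vb vp wb wp) (x : ob F wb wp) →
          at (act F φ x) ≡ act G φ (at x)
open BPHomSet public

record IsIso {F G : BPSet} (α : BPHomSet F G) : Set where
  field
    inv   : BPHomSet G F
    left  : ∀ {b p} (x : ob F b p) → at inv (at α x) ≡ x
    right : ∀ {b p} (y : ob G b p) → at α (at inv y) ≡ y

_≅_ : BPSet → BPSet → Set
F ≅ G = Σ (BPHomSet F G) IsIso

⊓ : ∀ {vb vp wb wp} → BPHom vb vp wb wp → CubeHom vb wb
⊓ φ = bridge φ

△ : CSet → BPSet
△ Θ = record
  { ob = λ b p → CSet.ob Θ b
  ; act = λ φ → CSet.act Θ (⊓ φ)
  ; act-id = CSet.act-id Θ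
  ; act-∘ = λ ψ φ → CSet.act-∘ Θ (⊓ ψ) (⊓ φ) }

♮ : ∀ {vb vp wb wp} → BPHom vb vp wb wp → BPHom vb 0 wb 0
♮ φ = bphom (bridge φ) []

♭ : BPSet → BPSet
♭ Γ = record
  { ob = λ b p → ob Γ b 0
  ; act = λ φ → act Γ (♮ φ)
  ; act-id = act-id Γ
  ; act-∘ = λ ψ φ → act-∘ Γ (♮ ψ) (♮ φ) }

ς : ∀ {b p} → BPHom b p b 0
ς = bphom idᶜ []

private
  ⟪id⟫ : ∀ {n} (x : Val n) → x ⟪ idᶜ ⟫ ≡ x
  ⟪id⟫ 𝟎 = refl
  ⟪id⟫ 𝟏 = refl
  ⟪id⟫ (var j) = lookup∘tabulate var j

  map⟪id⟫ : ∀ {n m} (xs : Vec (Val n) m) → map (_⟪ idᶜ ⟫) xs ≡ xs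
  map⟪id⟫ [] = refl
  map⟪id⟫ (x ∷ xs) = cong₂ _∷_ (⟪id⟫ x) (map⟪id⟫ xs)

  id∘ : ∀ {u v} (φ : CubeHom u v) → idᶜ ∘ᶜ φ ≡ φ
  id∘ φ = trans (sym (tabulate-∘ (_⟪ φ ⟫) var)) (tabulate∘lookup φ)

  κ-nat : ∀ {vb vp wb wp} (φ : BPHom vb vp wb wp) →
          (♮ φ ∘ᵇᵖ ς {vb} {vp}) ≡ (ς {wb} {wp} ∘ᵇᵖ φ)
  κ-nat (bphom β π) = cong (λ z → bphom z []) (trans (map⟪id⟫ β) (sym (id∘ β)))

κ : (Γ : BPSet) → BPHomSet (♭ Γ) Γ
κ Γ = record
  { at = act Γ ς
  ; nat = λ φ x → trans (sym (act-∘ Γ (♮ φ) ς x))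
                   (trans (cong (λ h → act Γ h x) (κ-nat φ)) (act-∘ Γ ς φ x)) }

-- weakening (∖i) : (W, i:P) → W; the fresh path variable is index zero
weaken : ∀ {b p} → BPHom b (suc p) b p
weaken = bphom idᶜ (tabulate (λ j → pv (suc j)))

Discrete : BPSet → Set
Discrete Γ = ∀ {b p} (γ : ob Γ b (suc p)) →
  Σ (ob Γ b p) (λ γ′ → γ ≡ act Γ weaken γ′)

module Submission where

open import Defs
open import Data.Nat using (zero; suc)
open import Data.Product using (Σ; _×_; _,_)
open import Data.Vec using ([]; replicate)
open import Data.Vec.Properties using (tabulate-∘; tabulate∘lookup)
open import Relation.Binary.PropositionalEquality
open ≡-Reasoning

∘ᶜ-identityˡ : ∀ {u v} (φ : CubeHom u v) → idᶜ ∘ᶜ φ ≡ φ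
∘ᶜ-identityˡ φ = trans (sym (tabulate-∘ (_⟪ φ ⟫) var)) (tabulate∘lookup φ)

module _ {F G : BPSet} (α : BPHomSet F G) where

  -- A natural map whose components are bijections is an isomorphism:
  -- naturality of the componentwise inverse is automatic.
  componentwise-inverse→IsIso :
    (β : ∀ {b p} → ob G b p → ob F b p) →
    (∀ {b p} (x : ob F b p) → β (at α x) ≡ x) →
    (∀ {b p} (y : ob G b p) → at α (β y) ≡ y) →
    IsIso α
  componentwise-inverse→IsIso β βα αβ = record
    { inv = record { at = β ; nat = β-nat } ; left = βα ; right = αβ }
    where
      β-nat : ∀ {vb vp wb wp} (φ : BPHom vb vp wb wp) (y : ob G wb wp) →
              β (act G φ y) ≡ act F φ (β y)
      β-nat φ y = begin
        β (act G φ y)                 ≡⟨ cong (λ y′ → β (act G φ y′)) (sym (αβ y)) ⟩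
        β (act G φ (at α (β y)))      ≡⟨ cong β (sym (nat α φ (β y))) ⟩
        β (at α (act F φ (β y)))      ≡⟨ βα (act F φ (β y)) ⟩
        act F φ (β y)                 ∎

  retraction-surjective→IsIso :
    (r : ∀ {b p} → ob G b p → ob F b p) →
    (∀ {b p} (x : ob F b p) → r (at α x) ≡ x) →
    (∀ {b p} (y : ob G b p) → Σ (ob F b p) (λ x → y ≡ at α x)) →
    IsIso α
  retraction-surjective→IsIso r rα surj = componentwise-inverse→IsIso r rα αr
    where
      αr : ∀ {b p} (y : ob G b p) → at α (r y) ≡ y
      αr y with surj y
      ... | x , refl = cong (at α) (rα x)

≅-sym : ∀ {F G} → F ≅ G → G ≅ F
≅-sym (α , iso) = IsIso.inv iso , record
  { inv = α ; left = IsIso.right iso ; right = IsIso.left iso }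

-- △Θ is discrete: weakening acts on △Θ as Θ(idᶜ), i.e. trivially.
△-discrete : (Θ : CSet) → Discrete (△ Θ)
△-discrete Θ γ = γ , sym (CSet.act-id Θ γ)

discrete-transport : ∀ {F G} → F ≅ G → Discrete G → Discrete F
discrete-transport {F} {G} (α , iso) discG γ with discG (at α γ)
... | γ′ , αγ≡wγ′ = at β γ′ , (begin
  γ                         ≡⟨ sym (IsIso.left iso γ) ⟩
  at β (at α γ)             ≡⟨ cong (at β) αγ≡wγ′ ⟩
  at β (act G weaken γ′)    ≡⟨ nat β weaken γ′ ⟩
  act F weaken (at β γ′)    ∎)
  where β = IsIso.inv iso

ς-∘ : ∀ {vb vp wb wp} (φ : BPHom vb vp wb wp) →
      ς {wb} {wp} ∘ᵇᵖ φ ≡ bphom (bridge φ) []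
ς-∘ φ = cong (λ β → bphom β []) (∘ᶜ-identityˡ (bridge φ))

-- σ_W : ♮W → W sends every path variable to 0; it is a section of ς_W.
σ : ∀ {b p} → BPHom b 0 b p
σ {b} {p} = bphom idᶜ (replicate p 𝟎)

module _ (Γ : BPSet) where

  κ-retraction : ∀ {b p} (x : ob Γ b 0) → act Γ (σ {b} {p}) (at (κ Γ) x) ≡ x
  κ-retraction {b} {p} x = begin
    act Γ σ (act Γ ς x)       ≡⟨ sym (act-∘ Γ ς σ x) ⟩
    act Γ (ς ∘ᵇᵖ σ {b} {p}) x ≡⟨ cong (λ h → act Γ h x) (ς-∘ (σ {b} {p})) ⟩
    act Γ idᵇᵖ x              ≡⟨ act-id Γ x ⟩
    x                         ∎

  -- Elements in the image of κ are invariant under weakening, as ς ∘ (∖i) = ς.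
  κ-weaken : ∀ {b p} (x : ob Γ b 0) →
             act Γ (weaken {b} {p}) (at (κ Γ) x) ≡ at (κ Γ) x
  κ-weaken x = begin
    act Γ weaken (act Γ ς x)   ≡⟨ sym (act-∘ Γ ς weaken x) ⟩
    act Γ (ς ∘ᵇᵖ weaken) x     ≡⟨ cong (λ h → act Γ h x) (ς-∘ weaken) ⟩
    act Γ ς x                  ∎

  -- In a discrete Γ every element comes from a bridge-only cube via κ:
  -- strip the path variables one at a time.
  discrete→κ-surjective : Discrete Γ →
    ∀ {b p} (y : ob Γ b p) → Σ (ob Γ b 0) (λ x → y ≡ at (κ Γ) x)
  discrete→κ-surjective disc {p = zero} y = y , sym (act-id Γ y)
  discrete→κ-surjective disc {p = suc p} y with disc y
  ... | y′ , y≡wy′ with discrete→κ-surjective disc y′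
  ... | x , refl = x , trans y≡wy′ (κ-weaken x)

  discrete→κ-iso : Discrete Γ → IsIso (κ Γ)
  discrete→κ-iso disc =
    retraction-surjective→IsIso (κ Γ) (act Γ σ) κ-retraction
      (discrete→κ-surjective disc)

  bridge-restriction : CSet
  bridge-restriction = record
    { ob = λ b → ob Γ b 0
    ; act = λ φ → act Γ (bphom φ [])
    ; act-id = act-id Γ
    ; act-∘ = λ ψ φ → act-∘ Γ (bphom ψ []) (bphom φ []) }

  ♭≡△ : ♭ Γ ≡ △ bridge-restriction
  ♭≡△ = refl

  κ-iso→≅△ : IsIso (κ Γ) → Σ CSet (λ Θ → Γ ≅ △ Θ)
  κ-iso→≅△ iso =
    bridge-restriction , subst (Γ ≅_) ♭≡△ (≅-sym (κ Γ , iso))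

  -- (2) ⇒ (1).  The number p of path variables must be passed on explicitly:
  -- the elements of △Θ do not mention it.
  ≅△→discrete : Σ CSet (λ Θ → Γ ≅ △ Θ) → Discrete Γ
  ≅△→discrete (Θ , Γ≅△Θ) = discrete-transport Γ≅△Θ (λ {b} {p} → △-discrete Θ {b} {p})

proposition4p20 : (Γ : BPSet) →
    (Discrete Γ → Σ CSet (λ Θ → Γ ≅ △ Θ)) ×
    (Σ CSet (λ Θ → Γ ≅ △ Θ) → IsIso (κ Γ)) ×
    (IsIso (κ Γ) → Discrete Γ)
proposition4p20 Γ =
  (λ disc → κ-iso→≅△ Γ (discrete→κ-iso Γ disc)) ,
  (λ iso△ → discrete→κ-iso Γ (≅△→discrete Γ iso△)) ,
  (λ isoκ → ≅△→discrete Γ (κ-iso→≅△ Γ isoκ))
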